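{- Let $d\ge 2$ and let $\mathbb{F}$ be a field such that either $\mathrm{char}\,\mathbb{F}=0$, or $\mathrm{char}\,\mathbb{F}=p>d$ and $|\mathbb{F}|\ge 2d-1$. For $t\in\mathbb{F}$ let $a(t)=(1,t,t^2,\dots,t^d)$ and $\dot a(t)=(0,1,2t,3t^2,\dots,dt^{d-1})$, and let $\ell_t$ be the line of $\mathrm{PG}(d,\mathbb{F})$ spanned by the points with homogeneous co-ordinates $a(t)$ and $\dot a(t)$ (the tangent line of the moment curve at $a(t)$). Then there is no projective subspace of co-dimension two in $\mathrm{PG}(d,\mathbb{F})$ meeting every line $\ell_t$, $t\in\mathbb{F}$. -}

module Defs where

open import Level using (Level; _⊔_; suc)
open import Data.Nat as ℕ using (ℕ; zero; _∸_; _<_)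
import Data.Nat as N
open import Data.Fin using (Fin; toℕ)
open import Data.Product using (Σ; ∃; _×_; _,_)
open import Data.Sum using (_⊎_)
open import Relation.Nullary using (¬_)
open import Algebra.Bundles using (CommutativeRing)
import Algebra.Bundles
import Algebra.Definitions.RawSemiring as RS

record Field (c ℓ : Level) : Set (Level.suc (c ⊔ ℓ)) where
  field
    commutativeRing : CommutativeRing c ℓ
  open CommutativeRing commutativeRing public
  field
    1≉0     : ¬ (1# ≈ 0#)
    inverse : ∀ x → ¬ (x ≈ 0#) → ∃ λ y → x * y ≈ 1#

module FieldDefs {c ℓ : Level} (F : Field c ℓ) where
  open Field F
  open RS (Algebra.Bundles.Semiring.rawSemiring semiring) public using (sum; _^_) renaming (_×_ to _·_)

  natF : ℕ → Carrier
  natF n = n · 1#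

  CharZero : Set ℓ
  CharZero = ∀ n → ¬ (natF (N.suc n) ≈ 0#)

  CharIs : ℕ → Set ℓ
  CharIs p = (0 < p) × (natF p ≈ 0#) × (∀ m → 0 < m → m < p → ¬ (natF m ≈ 0#))

  CardAtLeast : ℕ → Set (c ⊔ ℓ)
  CardAtLeast m = Σ (Fin m → Carrier) λ f → ∀ i j → f i ≈ f j → i ≡ j
    where open import Relation.Binary.PropositionalEquality using (_≡_)

  -- vectors of F^(d+1), i.e. homogeneous co-ordinates of PG(d,F)
  Vec : ℕ → Set c
  Vec d = Fin (N.suc d) → Carrier

  a : (d : ℕ) → Carrier → Vec d
  a d t i = t ^ toℕ i

  ȧ : (d : ℕ) → Carrier → Vec d
  ȧ d t i = natF (toℕ i) * (t ^ (toℕ i ∸ 1))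

  NonZero : {d : ℕ} → Vec d → Set ℓ
  NonZero {d} v = ¬ (∀ i → v i ≈ 0#)

  lincomb : {d m : ℕ} → (Fin m → Carrier) → (Fin m → Vec d) → Vec d
  lincomb cs w i = sum (λ k → cs k * w k i)

  LinIndep : {d m : ℕ} → (Fin m → Vec d) → Set (c ⊔ ℓ)
  LinIndep {d} {m} w = ∀ (cs : Fin m → Carrier) → (∀ i → lincomb cs w i ≈ 0#) → ∀ k → cs k ≈ 0#

  -- the projective subspace spanned by the linearly independent vectors
  -- w (a subspace of projective dimension m-1) meets the line ℓ_t spanned by
  -- a(t) and ȧ(t): some point (nonzero vector) lies in both spans.
  MeetsTangent : {d m : ℕ} → (Fin m → Vec d) → Carrier → Set (c ⊔ ℓ)
  MeetsTangent {d} {m} w t =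
    ∃ λ (v : Vec d) → NonZero v
      × (∃ λ (λμ : Carrier × Carrier) → ∀ i → v i ≈ (Data.Product.proj₁ λμ * a d t i + Data.Product.proj₂ λμ * ȧ d t i))
      × (∃ λ (cs : Fin m → Carrier) → ∀ i → v i ≈ lincomb cs w i)
    where import Data.Product

-- Suppose a subspace S of co-dimension two meets every tangent line ℓ_t. Its annihilator
-- has dimension at least two, so it contains a nonzero linear form f with f_d = 0 and, if i
-- is the least index with f_i ≠ 0, a nonzero form g with g_i = 0. Read f and g as
-- polynomials F(t) = Σ f_k t^k of degree < d and G of degree ≤ d. That ℓ_t meets S means
-- that some (α, β) ≠ 0 satisfies αF(t) + βF′(t) = 0 = αG(t) + βG′(t), so the Wronskian
-- W = F G′ − G F′ vanishes at t. Since W has degree ≤ 2d − 2 and the field has at least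
-- 2d − 1 elements, W = 0. But if j is the least index with g_j ≠ 0, then j ≠ i and the
-- coefficient of t^(i+j−1) in W is f_i g_j (j − i) ≠ 0, because 0 < |j − i| ≤ d < char 𝔽.
--
-- Equality in the field is not decidable, so the case distinctions are made under a double
-- negation; this is harmless because the goal is ⊥.

module Submission where

open import Defs
open import Algebra.Bundles using (CommutativeRing; Semiring)
import Algebra.Definitions.RawSemiring as RawSemiring
open import Data.Empty using (⊥-elim)
open import Data.Fin as Fin using (Fin; toℕ; zero; suc; punchIn; punchOut)
import Data.Fin.Properties as Fin
open import Data.List using (List; []; _∷_; length; map; tabulate)
open import Data.List.Properties using (length-map; length-tabulate)
open import Data.Nat as ℕ using (ℕ; zero; suc; z≤n; s≤s; _∸_; _<_; _≤_)
import Data.Nat.Properties as ℕ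
open import Data.Nat.Tactic.RingSolver using (solve-∀)
open import Data.Product using (Σ; ∃; _×_; _,_; proj₁; proj₂)
open import Data.Sum using (_⊎_; inj₁; inj₂)
open import Data.Vec.Functional as V using (Vector; head; tail)
open import Function using (_∘_; case_of_)
open import Function.Definitions using (Injective)
open import Relation.Binary.Definitions using (tri<; tri≈; tri>)
open import Relation.Binary.PropositionalEquality as ≡ using (_≡_; _≢_)
open import Relation.Nullary using (¬_; yes; no)
open import Relation.Nullary.Decidable using (¬¬-excluded-middle)

¬¬-Π-Fin : ∀ {p} n {P : Fin n → Set p} → (∀ i → ¬ ¬ P i) → ¬ ¬ (∀ i → P i)
¬¬-Π-Fin zero    ¬¬P k = k λ ()
¬¬-Π-Fin (suc n) ¬¬P k =
  ¬¬P zero λ P₀ → ¬¬-Π-Fin n (¬¬P ∘ suc) λ Pₛ → k λ { zero → P₀ ; (suc i) → Pₛ i }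

¬¬-∀⊎∃¬ : ∀ {p n} (P : Fin n → Set p) → ¬ ¬ ((∀ i → P i) ⊎ ∃ λ i → ¬ P i)
¬¬-∀⊎∃¬ {n = n} P k = ¬¬-Π-Fin n (λ i ¬Pᵢ → k (inj₂ (i , ¬Pᵢ))) (k ∘ inj₁)

module Polynomial {c ℓ} (R : CommutativeRing c ℓ) where
  open CommutativeRing R hiding (zero)
  open RawSemiring (Semiring.rawSemiring semiring) using (_^_) renaming (_×_ to _·_)
  open import Algebra.Properties.Semiring.Sum semiring using (sum; sum-cong-≋; *-distribˡ-sum)
  open import Algebra.Properties.Ring ring using (-1*x≈-x; x[y-z]≈xy-xz)
  open import Algebra.Solver.Ring.NaturalCoefficients.Default commutativeSemiring
    using (solve; _:+_; _:*_; _:=_; con)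
  open import Relation.Binary.Reasoning.Setoid setoid

  natR : ℕ → Carrier
  natR n = n · 1#

  -- Coefficient lists, lowest degree first.
  Poly : Set c
  Poly = List Carrier

  eval : Poly → Carrier → Carrier
  eval []      t = 0#
  eval (x ∷ p) t = x + t * eval p t

  coef : Poly → ℕ → Carrier
  coef []      _       = 0#
  coef (x ∷ p) zero    = x
  coef (x ∷ p) (suc k) = coef p k

  IsZero : Poly → Set ℓ
  IsZero p = ∀ k → coef p k ≈ 0#

  VanishesBelow : Poly → ℕ → Set ℓ
  VanishesBelow p i = ∀ k → k < i → coef p k ≈ 0#

  infixl 6 _⊕_ _⊖_
  infixl 7 _⊗_

  _⊕_ : Poly → Poly → Poly
  []      ⊕ q       = q
  (x ∷ p) ⊕ []      = x ∷ p
  (x ∷ p) ⊕ (y ∷ q) = (x + y) ∷ (p ⊕ q)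

  scale : Carrier → Poly → Poly
  scale x = map (x *_)

  _⊖_ : Poly → Poly → Poly
  p ⊖ q = p ⊕ scale (- 1#) q

  _⊗_ : Poly → Poly → Poly
  []      ⊗ q = []
  (x ∷ p) ⊗ q = scale x q ⊕ (0# ∷ (p ⊗ q))

  derivative′ : ℕ → Poly → Poly
  derivative′ n []      = []
  derivative′ n (x ∷ p) = (natR n * x) ∷ derivative′ (suc n) p

  derivative : Poly → Poly
  derivative []      = []
  derivative (x ∷ p) = derivative′ 1 p

  wronskian : Poly → Poly → Poly
  wronskian p q = p ⊗ derivative q ⊖ q ⊗ derivative p

  eval-⊕ : ∀ p q t → eval (p ⊕ q) t ≈ eval p t + eval q t
  eval-⊕ []      q       t = sym (+-identityˡ _)
  eval-⊕ (x ∷ p) []      t = sym (+-identityʳ _)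
  eval-⊕ (x ∷ p) (y ∷ q) t = begin
    (x + y) + t * eval (p ⊕ q) t            ≈⟨ +-congˡ (*-congˡ (eval-⊕ p q t)) ⟩
    (x + y) + t * (eval p t + eval q t)     ≈⟨ shuffle x y t (eval p t) (eval q t) ⟩
    (x + t * eval p t) + (y + t * eval q t) ∎
    where
    shuffle : ∀ x y t P Q → (x + y) + t * (P + Q) ≈ (x + t * P) + (y + t * Q)
    shuffle = solve 5 (λ x y t P Q → (x :+ y) :+ t :* (P :+ Q) := (x :+ t :* P) :+ (y :+ t :* Q)) refl

  eval-scale : ∀ x p t → eval (scale x p) t ≈ x * eval p t
  eval-scale x []      t = sym (zeroʳ x)
  eval-scale x (y ∷ p) t = begin
    x * y + t * eval (scale x p) t ≈⟨ +-congˡ (*-congˡ (eval-scale x p t)) ⟩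
    x * y + t * (x * eval p t)     ≈⟨ factor x y t (eval p t) ⟩
    x * (y + t * eval p t)         ∎
    where
    factor : ∀ x y t P → x * y + t * (x * P) ≈ x * (y + t * P)
    factor = solve 4 (λ x y t P → x :* y :+ t :* (x :* P) := x :* (y :+ t :* P)) refl

  eval-⊖ : ∀ p q t → eval (p ⊖ q) t ≈ eval p t - eval q t
  eval-⊖ p q t = trans (eval-⊕ p _ t) (+-congˡ (trans (eval-scale (- 1#) q t) (-1*x≈-x _)))

  eval-⊗ : ∀ p q t → eval (p ⊗ q) t ≈ eval p t * eval q t
  eval-⊗ []      q t = sym (zeroˡ _)
  eval-⊗ (x ∷ p) q t = begin
    eval (scale x q ⊕ (0# ∷ (p ⊗ q))) t            ≈⟨ eval-⊕ (scale x q) _ t ⟩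
    eval (scale x q) t + (0# + t * eval (p ⊗ q) t) ≈⟨ +-cong (eval-scale x q t) (+-identityˡ _) ⟩
    x * eval q t + t * eval (p ⊗ q) t              ≈⟨ +-congˡ (*-congˡ (eval-⊗ p q t)) ⟩
    x * eval q t + t * (eval p t * eval q t)       ≈⟨ factor x (eval q t) t (eval p t) ⟩
    (x + t * eval p t) * eval q t                  ∎
    where
    factor : ∀ x Q t P → x * Q + t * (P * Q) ≈ (x + t * P) * Q
    factor = solve 4 (λ x Q t P → x :* Q :+ t :* (P :* Q) := (x :+ t :* P) :* Q) refl

  coef-⊕ : ∀ p q k → coef (p ⊕ q) k ≈ coef p k + coef q k
  coef-⊕ []      q       k       = sym (+-identityˡ _)
  coef-⊕ (x ∷ p) []      k       = sym (+-identityʳ _)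
  coef-⊕ (x ∷ p) (y ∷ q) zero    = refl
  coef-⊕ (x ∷ p) (y ∷ q) (suc k) = coef-⊕ p q k

  coef-scale : ∀ x p k → coef (scale x p) k ≈ x * coef p k
  coef-scale x []      k       = sym (zeroʳ x)
  coef-scale x (y ∷ p) zero    = refl
  coef-scale x (y ∷ p) (suc k) = coef-scale x p k

  coef-⊖ : ∀ p q k → coef (p ⊖ q) k ≈ coef p k - coef q k
  coef-⊖ p q k = trans (coef-⊕ p _ k) (+-congˡ (trans (coef-scale (- 1#) q k) (-1*x≈-x _)))

  coef-∷-⊗ : ∀ x p q k → coef ((x ∷ p) ⊗ q) k ≈ x * coef q k + coef (0# ∷ (p ⊗ q)) k
  coef-∷-⊗ x p q k = trans (coef-⊕ (scale x q) _ k) (+-congʳ (coef-scale x q k))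

  coef-derivative′ : ∀ n p k → coef (derivative′ n p) k ≈ natR (n ℕ.+ k) * coef p k
  coef-derivative′ n []      k       = sym (zeroʳ _)
  coef-derivative′ n (x ∷ p) zero    =
    reflexive (≡.cong (λ m → natR m * x) (≡.sym (ℕ.+-identityʳ n)))
  coef-derivative′ n (x ∷ p) (suc k) = trans (coef-derivative′ (suc n) p k)
    (reflexive (≡.cong (λ m → natR m * coef p k) (≡.sym (ℕ.+-suc n k))))

  coef-derivative : ∀ p k → coef (derivative p) k ≈ natR (suc k) * coef p (suc k)
  coef-derivative []      k = sym (zeroʳ _)
  coef-derivative (x ∷ p) k = coef-derivative′ 1 p k

  coef-tabulate : ∀ {n} (h : Vector Carrier n) i → coef (tabulate h) (toℕ i) ≡ h i
  coef-tabulate h zero    = ≡.refl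
  coef-tabulate h (suc i) = coef-tabulate (tail h) i

  coef≉0⇒<length : ∀ p i → ¬ coef p i ≈ 0# → i < length p
  coef≉0⇒<length []      i       pᵢ≉0 = ⊥-elim (pᵢ≉0 refl)
  coef≉0⇒<length (x ∷ p) zero    _    = s≤s z≤n
  coef≉0⇒<length (x ∷ p) (suc i) pᵢ≉0 = s≤s (coef≉0⇒<length p i pᵢ≉0)

  ¬¬-lowest-nonzero-coef : ∀ p → ¬ IsZero p → ¬ ¬ (∃ λ i → ¬ coef p i ≈ 0# × VanishesBelow p i)
  ¬¬-lowest-nonzero-coef []      p≉0 k = p≉0 (λ _ → refl)
  ¬¬-lowest-nonzero-coef (x ∷ p) p≉0 k = ¬¬-excluded-middle λ
    { (no x≉0)  → k (0 , x≉0 , λ _ ())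
    ; (yes x≈0) → ¬¬-lowest-nonzero-coef p (λ p≈0 → p≉0 λ { zero → x≈0 ; (suc m) → p≈0 m })
        λ (i , pᵢ≉0 , below) →
          k (suc i , pᵢ≉0 , λ { zero _ → x≈0 ; (suc m) (s≤s m<i) → below m m<i }) }

  private
    +-zero : ∀ {x y} → x ≈ 0# → y ≈ 0# → x + y ≈ 0#
    +-zero x≈0 y≈0 = trans (+-cong x≈0 y≈0) (+-identityˡ 0#)

    *-zeroʳ : ∀ x {y} → y ≈ 0# → x * y ≈ 0#
    *-zeroʳ x y≈0 = trans (*-congˡ y≈0) (zeroʳ x)

    *-zeroˡ : ∀ {x} y → x ≈ 0# → x * y ≈ 0#
    *-zeroˡ y x≈0 = trans (*-congʳ x≈0) (zeroˡ y)

    vanishesBelow-tail : ∀ {x p i} → VanishesBelow (x ∷ p) (suc i) → VanishesBelow p i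
    vanishesBelow-tail below m m<i = below (suc m) (s≤s m<i)

  vanishesBelow-0∷ : ∀ {p i} → VanishesBelow p i → VanishesBelow (0# ∷ p) (suc i)
  vanishesBelow-0∷ below zero    _         = refl
  vanishesBelow-0∷ below (suc k) (s≤s k<i) = below k k<i

  vanishesBelow-⊗ : ∀ p q i j → VanishesBelow p i → VanishesBelow q j →
                    VanishesBelow (p ⊗ q) (i ℕ.+ j)
  vanishesBelow-⊗ []      q i       j _  _  _ _  = refl
  vanishesBelow-⊗ (x ∷ p) q zero    j _  q< k k< = trans (coef-∷-⊗ x p q k)
    (+-zero (*-zeroʳ x (q< k k<))
            (vanishesBelow-0∷ (vanishesBelow-⊗ p q 0 j (λ _ ()) q<) k (ℕ.m<n⇒m<1+n k<)))
  vanishesBelow-⊗ (x ∷ p) q (suc i) j p< q< k k< = trans (coef-∷-⊗ x p q k)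
    (+-zero (*-zeroˡ _ (p< 0 (s≤s z≤n)))
            (vanishesBelow-0∷ (vanishesBelow-⊗ p q i j (vanishesBelow-tail p<) q<) k k<))

  coef-⊗-lowest : ∀ p q i j → VanishesBelow p i → VanishesBelow q j →
                  coef (p ⊗ q) (i ℕ.+ j) ≈ coef p i * coef q j
  coef-⊗-lowest []      q i       j _  _  = sym (zeroˡ _)
  coef-⊗-lowest (x ∷ p) q zero    j _  q< = trans (coef-∷-⊗ x p q j) (trans
    (+-congˡ (vanishesBelow-0∷ (vanishesBelow-⊗ p q 0 j (λ _ ()) q<) j (ℕ.n<1+n j)))
    (+-identityʳ _))
  coef-⊗-lowest (x ∷ p) q (suc i) j p< q< = trans (coef-∷-⊗ x p q (suc i ℕ.+ j)) (trans
    (+-cong (*-zeroˡ _ (p< 0 (s≤s z≤n))) (coef-⊗-lowest p q i j (vanishesBelow-tail p<) q<))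
    (+-identityˡ _))

  coef-⊗-derivative-lowest : ∀ p q i j → VanishesBelow p i → VanishesBelow q j → 1 ≤ i ℕ.+ j →
                             coef (p ⊗ derivative q) (i ℕ.+ j ∸ 1) ≈ coef p i * (natR j * coef q j)
  coef-⊗-derivative-lowest p q i zero p< q< 1≤i+0 = begin
    coef (p ⊗ derivative q) (i ℕ.+ 0 ∸ 1)
      ≈⟨ vanishesBelow-⊗ p (derivative q) i 0 p< (λ _ ()) _ (ℕ.∸-monoˡ-< (ℕ.n<1+n _) 1≤i+0) ⟩
    0#
      ≈⟨ *-zeroʳ _ (zeroˡ _) ⟨
    coef p i * (0# * coef q 0)
      ∎
  coef-⊗-derivative-lowest p q i (suc j) p< q< _ = begin
    coef (p ⊗ derivative q) (i ℕ.+ suc j ∸ 1)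
      ≡⟨ ≡.cong (λ e → coef (p ⊗ derivative q) (e ∸ 1)) (ℕ.+-suc i j) ⟩
    coef (p ⊗ derivative q) (i ℕ.+ j)
      ≈⟨ coef-⊗-lowest p (derivative q) i j p< derivative-below ⟩
    coef p i * coef (derivative q) j
      ≈⟨ *-congˡ (coef-derivative q j) ⟩
    coef p i * (natR (suc j) * coef q (suc j))
      ∎
    where
    derivative-below : VanishesBelow (derivative q) j
    derivative-below k k<j = trans (coef-derivative q k) (*-zeroʳ _ (q< (suc k) (s≤s k<j)))

  coef-wronskian-lowest : ∀ p q i j → VanishesBelow p i → VanishesBelow q j → 1 ≤ i ℕ.+ j →
                          coef (wronskian p q) (i ℕ.+ j ∸ 1) ≈ coef p i * coef q j * (natR j - natR i)
  coef-wronskian-lowest p q i j p< q< 1≤i+j = begin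
    coef (wronskian p q) e                                ≈⟨ coef-⊖ (p ⊗ derivative q) _ e ⟩
    coef (p ⊗ derivative q) e - coef (q ⊗ derivative p) e ≈⟨ -‿cong₂ pDq qDp ⟩
    pᵢ * (natR j * qⱼ) - qⱼ * (natR i * pᵢ)               ≈⟨ -‿cong₂ (rearrange pᵢ (natR j) qⱼ)
                                                                      (rearrange′ qⱼ (natR i) pᵢ) ⟩
    pᵢ * qⱼ * natR j - pᵢ * qⱼ * natR i                   ≈⟨ x[y-z]≈xy-xz (pᵢ * qⱼ) _ _ ⟨
    pᵢ * qⱼ * (natR j - natR i)                           ∎
    where
    e = i ℕ.+ j ∸ 1
    pᵢ = coef p i
    qⱼ = coef q j
    -‿cong₂ : ∀ {x x′ y y′} → x ≈ x′ → y ≈ y′ → x - y ≈ x′ - y′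
    -‿cong₂ x≈ y≈ = +-cong x≈ (-‿cong y≈)
    rearrange : ∀ a n b → a * (n * b) ≈ a * b * n
    rearrange = solve 3 (λ a n b → a :* (n :* b) := a :* b :* n) refl
    rearrange′ : ∀ b n a → b * (n * a) ≈ a * b * n
    rearrange′ = solve 3 (λ b n a → b :* (n :* a) := a :* b :* n) refl
    pDq : coef (p ⊗ derivative q) e ≈ pᵢ * (natR j * qⱼ)
    pDq = coef-⊗-derivative-lowest p q i j p< q< 1≤i+j
    qDp : coef (q ⊗ derivative p) e ≈ qⱼ * (natR i * pᵢ)
    qDp = ≡.subst (λ m → coef (q ⊗ derivative p) (m ∸ 1) ≈ qⱼ * (natR i * pᵢ)) (ℕ.+-comm j i)
            (coef-⊗-derivative-lowest q p j i q< p< (≡.subst (1 ≤_) (ℕ.+-comm i j) 1≤i+j))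

  length-⊕ : ∀ {n} p q → length p ≤ n → length q ≤ n → length (p ⊕ q) ≤ n
  length-⊕ []      q       _        q≤       = q≤
  length-⊕ (x ∷ p) []      p≤       _        = p≤
  length-⊕ (x ∷ p) (y ∷ q) (s≤s p≤) (s≤s q≤) = s≤s (length-⊕ p q p≤ q≤)

  length-scale : ∀ x p → length (scale x p) ≡ length p
  length-scale x = length-map (x *_)

  length-⊖ : ∀ {n} p q → length p ≤ n → length q ≤ n → length (p ⊖ q) ≤ n
  length-⊖ p q p≤ q≤ = length-⊕ p _ p≤ (≡.subst (_≤ _) (≡.sym (length-scale (- 1#) q)) q≤)

  length-⊗ : ∀ p q n → length q ≤ suc n → length (p ⊗ q) ≤ length p ℕ.+ n
  length-⊗ []      q n _  = z≤n
  length-⊗ (x ∷ p) q n q≤ = length-⊕ (scale x q) _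
    (≡.subst (_≤ _) (≡.sym (length-scale x q)) (ℕ.≤-trans q≤ (s≤s (ℕ.m≤n+m n (length p)))))
    (s≤s (length-⊗ p q n q≤))

  length-derivative′ : ∀ n p → length (derivative′ n p) ≡ length p
  length-derivative′ n []      = ≡.refl
  length-derivative′ n (x ∷ p) = ≡.cong suc (length-derivative′ (suc n) p)

  length-derivative : ∀ p → length (derivative p) ≡ length p ∸ 1
  length-derivative []      = ≡.refl
  length-derivative (x ∷ p) = length-derivative′ 1 p

  length-wronskian : ∀ {p q} n → 2 ≤ n → length p ≤ n → length q ≤ suc n →
                     length (wronskian p q) ≤ 2 ℕ.* n ∸ 1
  length-wronskian {p} {q} (suc (suc m)) (s≤s (s≤s z≤n)) p≤ q≤ = length-⊖ (p ⊗ derivative q) _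
    (ℕ.≤-trans (length-⊗ p (derivative q) (suc m) (length-derivative≤ q q≤))
               (ℕ.≤-trans (ℕ.+-monoˡ-≤ (suc m) p≤) (ℕ.≤-reflexive (bound₁ m))))
    (ℕ.≤-trans (length-⊗ q (derivative p) m (length-derivative≤ p p≤))
               (ℕ.≤-trans (ℕ.+-monoˡ-≤ m q≤) (ℕ.≤-reflexive (bound₂ m))))
    where
    length-derivative≤ : ∀ {n} r → length r ≤ suc n → length (derivative r) ≤ n
    length-derivative≤ r r≤ = ≡.subst (_≤ _) (≡.sym (length-derivative r)) (ℕ.∸-monoˡ-≤ 1 r≤)
    -- The right-hand sides are 2 * suc (suc m) ∸ 1 in normal form.
    bound₁ : ∀ m → suc (suc m) ℕ.+ suc m ≡ suc (m ℕ.+ suc (suc (m ℕ.+ 0)))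
    bound₁ = solve-∀
    bound₂ : ∀ m → suc (suc (suc m)) ℕ.+ m ≡ suc (m ℕ.+ suc (suc (m ℕ.+ 0)))
    bound₂ = solve-∀

  -- Synthetic division: the quotient of p by X − r.
  quotient : Carrier → Poly → Poly
  quotient r []          = []
  quotient r (x ∷ [])    = []
  quotient r (x ∷ y ∷ p) = eval (y ∷ p) r ∷ quotient r (y ∷ p)

  -- p(t) − p(r) = (t − r) q(t), with both sides moved so that no subtraction occurs.
  eval-quotient : ∀ r p t → eval p t + r * eval (quotient r p) t ≈ t * eval (quotient r p) t + eval p r
  eval-quotient r []          t = solve 2 (λ r t → con 0 :+ r :* con 0 := t :* con 0 :+ con 0) refl r t
  eval-quotient r (x ∷ [])    t =
    solve 3 (λ x r t → (x :+ t :* con 0) :+ r :* con 0 := t :* con 0 :+ (x :+ r :* con 0)) refl x r t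
  eval-quotient r (x ∷ y ∷ p) t = begin
    (x + t * E) + r * (e + t * Q) ≈⟨ shuffle x t E r e Q ⟩
    (x + r * e) + t * (E + r * Q) ≈⟨ +-congˡ (*-congˡ (eval-quotient r (y ∷ p) t)) ⟩
    (x + r * e) + t * (t * Q + e) ≈⟨ shuffle′ x r e t Q ⟩
    t * (e + t * Q) + (x + r * e) ∎
    where
    E = eval (y ∷ p) t
    e = eval (y ∷ p) r
    Q = eval (quotient r (y ∷ p)) t
    shuffle : ∀ x t E r e Q → (x + t * E) + r * (e + t * Q) ≈ (x + r * e) + t * (E + r * Q)
    shuffle = solve 6 (λ x t E r e Q → (x :+ t :* E) :+ r :* (e :+ t :* Q)
                                    := (x :+ r :* e) :+ t :* (E :+ r :* Q)) refl
    shuffle′ : ∀ x r e t Q → (x + r * e) + t * (t * Q + e) ≈ t * (e + t * Q) + (x + r * e)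
    shuffle′ = solve 5 (λ x r e t Q → (x :+ r :* e) :+ t :* (t :* Q :+ e)
                                   := t :* (e :+ t :* Q) :+ (x :+ r :* e)) refl

  length-quotient : ∀ r p → length (quotient r p) ≡ length p ∸ 1
  length-quotient r []          = ≡.refl
  length-quotient r (x ∷ [])    = ≡.refl
  length-quotient r (x ∷ y ∷ p) = ≡.cong suc (length-quotient r (y ∷ p))

  isZero-quotient : ∀ r p → IsZero (quotient r p) → eval p r ≈ 0# → IsZero p
  isZero-quotient r []          _   _      _       = refl
  isZero-quotient r (x ∷ [])    _   p[r]≈0 zero    =
    trans (sym (trans (+-congˡ (zeroʳ r)) (+-identityʳ x))) p[r]≈0
  isZero-quotient r (x ∷ [])    _   _      (suc k) = refl
  isZero-quotient r (x ∷ y ∷ p) q≈0 p[r]≈0 zero    =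
    trans (sym (trans (+-congˡ (*-zeroʳ r (q≈0 0))) (+-identityʳ x))) p[r]≈0
  isZero-quotient r (x ∷ y ∷ p) q≈0 _      (suc k) =
    isZero-quotient r (y ∷ p) (q≈0 ∘ suc) (q≈0 0) k

  eval-tabulate : ∀ {n} (h : Vector Carrier n) t → eval (tabulate h) t ≈ sum (λ i → t ^ toℕ i * h i)
  eval-tabulate {zero}  h t = refl
  eval-tabulate {suc n} h t = +-cong (sym (*-identityˡ (head h))) (begin
    t * eval (tabulate (tail h)) t         ≈⟨ *-congˡ (eval-tabulate (tail h) t) ⟩
    t * sum (λ i → t ^ toℕ i * tail h i)   ≈⟨ *-distribˡ-sum {n} t _ ⟩
    sum (λ i → t * (t ^ toℕ i * tail h i)) ≈⟨ sum-cong-≋ {n} (λ i → sym (*-assoc t _ _)) ⟩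
    sum (λ i → t ^ suc (toℕ i) * tail h i) ∎)

  eval-derivative′-tabulate : ∀ {n} m (h : Vector Carrier n) t →
    eval (derivative′ m (tabulate h)) t ≈ sum (λ i → natR (m ℕ.+ toℕ i) * t ^ toℕ i * h i)
  eval-derivative′-tabulate {zero}  m h t = refl
  eval-derivative′-tabulate {suc n} m h t = +-cong
    (sym (trans (*-congʳ (*-identityʳ _)) (reflexive (≡.cong (λ k → natR k * head h) (ℕ.+-identityʳ m)))))
    (begin
      t * eval (derivative′ (suc m) (tabulate (tail h))) t
        ≈⟨ *-congˡ (eval-derivative′-tabulate (suc m) (tail h) t) ⟩
      t * sum (λ i → natR (suc m ℕ.+ toℕ i) * t ^ toℕ i * tail h i)
        ≈⟨ *-distribˡ-sum {n} t _ ⟩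
      sum (λ i → t * (natR (suc m ℕ.+ toℕ i) * t ^ toℕ i * tail h i))
        ≈⟨ sum-cong-≋ {n} (λ i → trans (shuffle t _ _ _)
             (*-congʳ (*-congʳ (reflexive (≡.cong natR (≡.sym (ℕ.+-suc m (toℕ i)))))))) ⟩
      sum (λ i → natR (m ℕ.+ suc (toℕ i)) * t ^ suc (toℕ i) * tail h i)
        ∎)
    where
    shuffle : ∀ t a u x → t * (a * u * x) ≈ a * (t * u) * x
    shuffle = solve 4 (λ t a u x → t :* (a :* u :* x) := a :* (t :* u) :* x) refl

  eval-derivative-tabulate : ∀ {n} (h : Vector Carrier n) t →
    eval (derivative (tabulate h)) t ≈ sum (λ i → natR (toℕ i) * t ^ (toℕ i ∸ 1) * h i)
  eval-derivative-tabulate {zero}  h t = refl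
  eval-derivative-tabulate {suc n} h t = begin
    eval (derivative′ 1 (tabulate (tail h))) t
      ≈⟨ eval-derivative′-tabulate 1 (tail h) t ⟩
    sum (λ i → natR (suc (toℕ i)) * t ^ toℕ i * tail h i)
      ≈⟨ +-identityˡ _ ⟨
    0# + sum (λ i → natR (suc (toℕ i)) * t ^ toℕ i * tail h i)
      ≈⟨ +-congʳ (trans (*-congʳ (zeroˡ _)) (zeroˡ _)) ⟨
    0# * t ^ 0 * head h + sum (λ i → natR (suc (toℕ i)) * t ^ toℕ i * tail h i)
      ∎

module _ {c ℓ} (F : Field c ℓ) where
  open Field F hiding (zero)
  open FieldDefs F using (CharZero; natF; sum; _^_; Vec; NonZero; lincomb; a; ȧ; MeetsTangent)
  open import Algebra.Properties.Semiring.Sum semiring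
    using (sum-cong-≋; sum-replicate-zero; sum-init-last; ∑-distrib-+; ∑-comm; *-distribˡ-sum; *-distribʳ-sum)
  open import Algebra.Properties.Ring ring
    using (x∙y⁻¹≈ε⇒x≈y; x≈y⇒x∙y⁻¹≈ε; x[y-z]≈xy-xz; -‿distribʳ-*; -1*x≈-x
          ; +-cancelˡ; +-cancelʳ)
  open import Algebra.Properties.Semiring.Mult semiring using (×-homo-+)
  open import Algebra.Solver.Ring.NaturalCoefficients.Default commutativeSemiring
    using (solve; _:+_; _:*_; _:=_)
  open import Relation.Binary.Reasoning.Setoid setoid
  open Polynomial commutativeRing

  x≉0⇒xy≈0⇒y≈0 : ∀ {x y} → ¬ x ≈ 0# → x * y ≈ 0# → y ≈ 0#
  x≉0⇒xy≈0⇒y≈0 {x} {y} x≉0 xy≈0 with inverse x x≉0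
  ... | x⁻¹ , xx⁻¹≈1 = begin
    y             ≈⟨ *-identityˡ y ⟨
    1# * y        ≈⟨ *-congʳ (trans (sym xx⁻¹≈1) (*-comm x x⁻¹)) ⟩
    x⁻¹ * x * y   ≈⟨ *-assoc x⁻¹ x y ⟩
    x⁻¹ * (x * y) ≈⟨ *-congˡ xy≈0 ⟩
    x⁻¹ * 0#      ≈⟨ zeroʳ x⁻¹ ⟩
    0#            ∎

  *-≉0 : ∀ {x y} → ¬ x ≈ 0# → ¬ y ≈ 0# → ¬ x * y ≈ 0#
  *-≉0 x≉0 y≉0 xy≈0 = y≉0 (x≉0⇒xy≈0⇒y≈0 x≉0 xy≈0)

  x≉y⇒x-y≉0 : ∀ {x y} → ¬ x ≈ y → ¬ x - y ≈ 0#
  x≉y⇒x-y≉0 x≉y = x≉y ∘ x∙y⁻¹≈ε⇒x≈y _ _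

  x≉y⇒xz≈yz⇒z≈0 : ∀ {x y z} → ¬ x ≈ y → x * z ≈ y * z → z ≈ 0#
  x≉y⇒xz≈yz⇒z≈0 {x} {y} {z} x≉y xz≈yz = x≉0⇒xy≈0⇒y≈0 (x≉y⇒x-y≉0 x≉y) (begin
    (x - y) * z   ≈⟨ *-comm _ z ⟩
    z * (x - y)   ≈⟨ x[y-z]≈xy-xz z x y ⟩
    z * x - z * y ≈⟨ x≈y⇒x∙y⁻¹≈ε (trans (*-comm z x) (trans xz≈yz (*-comm y z))) ⟩
    0#            ∎)

  CharExceeds : ℕ → Set ℓ
  CharExceeds B = ∀ k → 0 < k → k ≤ B → ¬ natF k ≈ 0#

  charZero⇒charExceeds : CharZero → ∀ B → CharExceeds B
  charZero⇒charExceeds char0 B (suc k) _ _ = char0 k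

  natF-≉ : ∀ {B m n} → CharExceeds B → m < n → n ≤ B → ¬ natF n ≈ natF m
  natF-≉ {B} {m} {n} char m<n n≤B nₙ≈nₘ =
    char (n ∸ m) (ℕ.m<n⇒0<n∸m m<n) (ℕ.≤-trans (ℕ.m∸n≤m n m) n≤B) (+-cancelˡ (natF m) _ _ (begin
      natF m + natF (n ∸ m) ≈⟨ ×-homo-+ 1# m (n ∸ m) ⟨
      natF (m ℕ.+ (n ∸ m))  ≡⟨ ≡.cong natF (ℕ.m+[n∸m]≡n (ℕ.<⇒≤ m<n)) ⟩
      natF n                ≈⟨ nₙ≈nₘ ⟩
      natF m                ≈⟨ +-identityʳ _ ⟨
      natF m + 0#           ∎))

  natF-injective : ∀ {B m n} → CharExceeds B → m ≤ B → n ≤ B → natF m ≈ natF n → m ≡ n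
  natF-injective {m = m} {n} char m≤B n≤B eq with ℕ.<-cmp m n
  ... | tri< m<n _ _ = ⊥-elim (natF-≉ char m<n n≤B (sym eq))
  ... | tri≈ _ m≡n _ = m≡n
  ... | tri> _ _ n<m = ⊥-elim (natF-≉ char n<m m≤B eq)

  natF∘toℕ-injective : ∀ {N} → CharExceeds N → Injective _≡_ _≈_ (λ (i : Fin N) → natF (toℕ i))
  natF∘toℕ-injective char eq =
    Fin.toℕ-injective (natF-injective char (ℕ.<⇒≤ (Fin.toℕ<n _)) (ℕ.<⇒≤ (Fin.toℕ<n _)) eq)

  sum-zero : ∀ {n} {f : Vector Carrier n} → (∀ i → f i ≈ 0#) → sum f ≈ 0#
  sum-zero {n} f≈0 = trans (sum-cong-≋ f≈0) (sum-replicate-zero n)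

  dot : ∀ {n} → Vector Carrier n → Vector Carrier n → Carrier
  dot u v = sum (λ i → u i * v i)

  dot-congˡ : ∀ {n} {u v : Vector Carrier n} x → (∀ i → u i ≈ v i) → dot u x ≈ dot v x
  dot-congˡ x u≈v = sum-cong-≋ (λ i → *-congʳ (u≈v i))

  dot-comm : ∀ {n} (u v : Vector Carrier n) → dot u v ≈ dot v u
  dot-comm u v = sum-cong-≋ (λ i → *-comm (u i) (v i))

  dot-+ˡ : ∀ {n} (u v x : Vector Carrier n) → dot (λ i → u i + v i) x ≈ dot u x + dot v x
  dot-+ˡ {n} u v x = trans (sum-cong-≋ (λ i → distribʳ (x i) (u i) (v i))) (∑-distrib-+ {n} _ _)

  dot-*ˡ : ∀ {n} a (u x : Vector Carrier n) → dot (λ i → a * u i) x ≈ a * dot u x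
  dot-*ˡ {n} a u x = trans (sum-cong-≋ (λ i → *-assoc a (u i) (x i))) (sym (*-distribˡ-sum {n} a _))

  dot-lincomb : ∀ {n m} cs (w : Fin m → Vec n) x → dot (lincomb cs w) x ≈ sum (λ k → cs k * dot (w k) x)
  dot-lincomb {n} {m} cs w x = begin
    sum (λ i → sum (λ k → cs k * w k i) * x i)
      ≈⟨ sum-cong-≋ (λ i → *-distribʳ-sum (x i) (λ k → cs k * w k i)) ⟩
    sum (λ i → sum (λ k → cs k * w k i * x i))
      ≈⟨ ∑-comm {suc n} {m} (λ i k → cs k * w k i * x i) ⟩
    sum (λ k → sum (λ i → cs k * w k i * x i))
      ≈⟨ sum-cong-≋ {m} (λ k → trans (sum-cong-≋ {suc n} (λ i → *-assoc (cs k) (w k i) (x i)))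
                                     (sym (*-distribˡ-sum {suc n} (cs k) (λ i → w k i * x i)))) ⟩
    sum (λ k → cs k * dot (w k) x)
      ∎

  basis : ∀ {n} → Fin n → Vector Carrier n
  basis zero    zero    = 1#
  basis zero    (suc _) = 0#
  basis (suc _) zero    = 0#
  basis (suc i) (suc j) = basis i j

  dot-basis : ∀ {n} (i : Fin n) x → dot (basis i) x ≈ x i
  dot-basis {suc n} zero    x = trans (+-cong (*-identityˡ _) (sum-zero {n} (λ i → zeroˡ _))) (+-identityʳ _)
  dot-basis {suc n} (suc i) x = trans (+-cong (zeroˡ _) (dot-basis i (tail x))) (+-identityˡ _)

  eliminate-pivot : ∀ {m n} (A : Fin (suc m) → Vector Carrier (suc n)) r₀ → ¬ A r₀ zero ≈ 0# →
    Σ (Fin m → Vector Carrier n) λ B →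
      ∀ y → (∀ r → dot (B r) y ≈ 0#) → Σ Carrier λ x₀ → ∀ r → dot (A r) (x₀ V.∷ y) ≈ 0#
  eliminate-pivot {m} {n} A r₀ pivot with inverse (A r₀ zero) pivot
  ... | a⁻¹ , aa⁻¹≈1 = B , λ y By≈0 → x₀ y , solves y By≈0
    where
    factor : Fin (suc m) → Carrier
    factor r = A r zero * - a⁻¹
    B : Fin m → Vector Carrier n
    B r k = A (punchIn r₀ r) (suc k) + factor (punchIn r₀ r) * A r₀ (suc k)
    a*-a⁻¹≈-1 : A r₀ zero * - a⁻¹ ≈ - 1#
    a*-a⁻¹≈-1 = trans (sym (-‿distribʳ-* _ _)) (-‿cong aa⁻¹≈1)
    x₀ : Vector Carrier n → Carrier
    x₀ y = - a⁻¹ * dot (tail (A r₀)) y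
    expand : ∀ r y → dot (A r) (x₀ y V.∷ y) ≈ dot (tail (A r)) y + factor r * dot (tail (A r₀)) y
    expand r y = solve 4 (λ a b s t → a :* (b :* s) :+ t := t :+ a :* b :* s) refl (A r zero) (- a⁻¹) _ _
    solves : ∀ y → (∀ r → dot (B r) y ≈ 0#) → ∀ r → dot (A r) (x₀ y V.∷ y) ≈ 0#
    solves y By≈0 r with r₀ Fin.≟ r
    ... | yes ≡.refl = begin
      dot (A r₀) (x₀ y V.∷ y) ≈⟨ expand r₀ y ⟩
      S + factor r₀ * S       ≈⟨ +-congˡ (*-congʳ a*-a⁻¹≈-1) ⟩
      S + - 1# * S            ≈⟨ +-congˡ (-1*x≈-x S) ⟩
      S - S                   ≈⟨ -‿inverseʳ S ⟩
      0#                      ∎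
      where S = dot (tail (A r₀)) y
    ... | no r₀≢r = ≡.subst (λ r → dot (A r) (x₀ y V.∷ y) ≈ 0#) (Fin.punchIn-punchOut r₀≢r) (begin
      dot (A r′) (x₀ y V.∷ y)                                      ≈⟨ expand r′ y ⟩
      dot (tail (A r′)) y + factor r′ * dot (tail (A r₀)) y        ≈⟨ +-congˡ (dot-*ˡ _ _ y) ⟨
      dot (tail (A r′)) y + dot (λ k → factor r′ * A r₀ (suc k)) y ≈⟨ dot-+ˡ _ _ y ⟨
      dot (B (punchOut r₀≢r)) y                                    ≈⟨ By≈0 (punchOut r₀≢r) ⟩
      0#                                                           ∎)
      where r′ = punchIn r₀ (punchOut r₀≢r)

  ¬¬-nonzero-solution : ∀ {m n} → m ≤ n → (A : Fin m → Vec n) →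
                        ¬ ¬ (∃ λ (x : Vec n) → NonZero x × ∀ r → dot (A r) x ≈ 0#)
  ¬¬-nonzero-solution {zero}          _         A k = k ((λ _ → 1#) , (λ 1≈0 → 1≉0 (1≈0 zero)) , λ ())
  ¬¬-nonzero-solution {suc m} {suc n} (s≤s m≤n) A k = ¬¬-∀⊎∃¬ (λ r → A r zero ≈ 0#) λ
    { (inj₁ column≈0) → k (basis zero , (λ e≈0 → 1≉0 (e≈0 zero)) ,
        λ r → trans (dot-comm (A r) (basis zero)) (trans (dot-basis zero (A r)) (column≈0 r)))
    ; (inj₂ (r₀ , pivot)) → let (B , lift) = eliminate-pivot A r₀ pivot in
        ¬¬-nonzero-solution m≤n B λ (y , y≢0 , By≈0) → let (x₀ , Ax≈0) = lift y By≈0 in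
        k (x₀ V.∷ y , (λ x≈0 → y≢0 (x≈0 ∘ suc)) , Ax≈0) }

  Annihilates : ∀ {d m} → Vec d → (Fin m → Vec d) → Set ℓ
  Annihilates h w = ∀ k → dot (w k) h ≈ 0#

  ¬¬-annihilator : ∀ {m d} → suc m ≤ d → (w : Fin m → Vec d) → ∀ i →
                   ¬ ¬ (∃ λ h → NonZero h × h i ≈ 0# × Annihilates h w)
  ¬¬-annihilator m<d w i k = ¬¬-nonzero-solution m<d (basis i V.∷ w) λ (h , h≢0 , h⊥) →
    k (h , h≢0 , trans (sym (dot-basis i h)) (h⊥ zero) , h⊥ ∘ suc)

  isZero-of-roots : ∀ {N} p → length p ≤ N → (r : Fin N → Carrier) → Injective _≡_ _≈_ r →
                    (∀ k → eval p (r k) ≈ 0#) → IsZero p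
  isZero-of-roots {zero}  []  _    _ _     _     _ = refl
  isZero-of-roots {suc N} p   len≤ r r-inj roots =
    isZero-quotient r₀ p (isZero-of-roots q len-q (r ∘ suc) (Fin.suc-injective ∘ r-inj) q-roots) (roots zero)
    where
    r₀ = r zero
    q = quotient r₀ p
    len-q : length q ≤ N
    len-q = ≡.subst (_≤ N) (≡.sym (length-quotient r₀ p)) (ℕ.∸-monoˡ-≤ 1 len≤)
    q-roots : ∀ k → eval q (r (suc k)) ≈ 0#
    q-roots k = x≉y⇒xz≈yz⇒z≈0 (λ rₖ≈r₀ → case r-inj rₖ≈r₀ of λ ()) (begin
      t * eval q t             ≈⟨ +-identityʳ _ ⟨
      t * eval q t + 0#        ≈⟨ +-congˡ (roots zero) ⟨
      t * eval q t + eval p r₀ ≈⟨ eval-quotient r₀ p t ⟨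
      eval p t + r₀ * eval q t ≈⟨ +-congʳ (roots (suc k)) ⟩
      0# + r₀ * eval q t       ≈⟨ +-identityˡ _ ⟩
      r₀ * eval q t            ∎)
      where t = r (suc k)

  ¬isZero-wronskian : ∀ {B} p q i j → CharExceeds B → i ≤ B → j ≤ B → i ≢ j →
                      ¬ coef p i ≈ 0# → VanishesBelow p i → ¬ coef q j ≈ 0# → VanishesBelow q j →
                      ¬ IsZero (wronskian p q)
  ¬isZero-wronskian p q i j char i≤B j≤B i≢j pᵢ≉0 p<i qⱼ≉0 q<j W≈0 =
    *-≉0 (*-≉0 pᵢ≉0 qⱼ≉0) (x≉y⇒x-y≉0 (i≢j ∘ ≡.sym ∘ natF-injective char j≤B i≤B))
      (trans (sym (coef-wronskian-lowest p q i j p<i q<j (0<i+j i j i≢j))) (W≈0 _))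
    where
    0<i+j : ∀ i j → i ≢ j → 0 < i ℕ.+ j
    0<i+j zero    zero    0≢0 = ⊥-elim (0≢0 ≡.refl)
    0<i+j zero    (suc j) _   = s≤s z≤n
    0<i+j (suc i) j       _   = s≤s z≤n

  -- (α, β) is in the kernel of the matrix with rows (x, x′) and (y, y′), so it kills the determinant.
  kernel-kills-det : ∀ {α β x x′ y y′} → α * x + β * x′ ≈ 0# → α * y + β * y′ ≈ 0# →
                     α * (x * y′ - y * x′) ≈ 0# × β * (x * y′ - y * x′) ≈ 0#
  kernel-kills-det {α} {β} {x} {x′} {y} {y′} eqx eqy =
      trans (x[y-z]≈xy-xz α _ _) (common-cancel (β * (x′ * y′))
        (trans (by-y′ α β x x′ y′) (trans (*-congʳ eqx) (zeroˡ y′)))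
        (trans (by-x′ α β x′ y y′) (trans (*-congʳ eqy) (zeroˡ x′))))
    , trans (x[y-z]≈xy-xz β _ _) (common-cancel (α * (x * y))
        (trans (by-x α β x y y′) (trans (*-congˡ eqy) (zeroʳ x)))
        (trans (by-y α β x x′ y) (trans (*-congˡ eqx) (zeroʳ y))))
    where
    common-cancel : ∀ {a b} c → a + c ≈ 0# → b + c ≈ 0# → a - b ≈ 0#
    common-cancel c a+c≈0 b+c≈0 = x≈y⇒x∙y⁻¹≈ε (+-cancelʳ c _ _ (trans a+c≈0 (sym b+c≈0)))
    by-y′ : ∀ α β x x′ y′ → α * (x * y′) + β * (x′ * y′) ≈ (α * x + β * x′) * y′
    by-y′ = solve 5 (λ α β x x′ y′ → α :* (x :* y′) :+ β :* (x′ :* y′)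
                                   := (α :* x :+ β :* x′) :* y′) refl
    by-x′ : ∀ α β x′ y y′ → α * (y * x′) + β * (x′ * y′) ≈ (α * y + β * y′) * x′
    by-x′ = solve 5 (λ α β x′ y y′ → α :* (y :* x′) :+ β :* (x′ :* y′)
                                   := (α :* y :+ β :* y′) :* x′) refl
    by-x : ∀ α β x y y′ → β * (x * y′) + α * (x * y) ≈ x * (α * y + β * y′)
    by-x = solve 5 (λ α β x y y′ → β :* (x :* y′) :+ α :* (x :* y) := x :* (α :* y :+ β :* y′)) refl
    by-y : ∀ α β x x′ y → β * (y * x′) + α * (x * y) ≈ y * (α * x + β * x′)
    by-y = solve 5 (λ α β x x′ y → β :* (y :* x′) :+ α :* (x :* y) := y :* (α :* x :+ β :* x′)) refl

  wronskian-root : ∀ {α β} p q t → ¬ (α ≈ 0# × β ≈ 0#) →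
                   α * eval p t + β * eval (derivative p) t ≈ 0# →
                   α * eval q t + β * eval (derivative q) t ≈ 0# →
                   ¬ ¬ (eval (wronskian p q) t ≈ 0#)
  wronskian-root {α} {β} p q t αβ≉0 eqp eqq W≉0 =
    αβ≉0 ( x≉0⇒xy≈0⇒y≈0 W≉0 (trans (*-comm _ α) αW≈0)
         , x≉0⇒xy≈0⇒y≈0 W≉0 (trans (*-comm _ β) βW≈0))
    where
    W≈det : eval (wronskian p q) t ≈ eval p t * eval (derivative q) t - eval q t * eval (derivative p) t
    W≈det = trans (eval-⊖ (p ⊗ derivative q) _ t) (+-cong (eval-⊗ p _ t) (-‿cong (eval-⊗ q _ t)))
    αW≈0 = trans (*-congˡ W≈det) (proj₁ (kernel-kills-det eqp eqq))
    βW≈0 = trans (*-congˡ W≈det) (proj₂ (kernel-kills-det eqp eqq))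

  tangent-condition : ∀ {d m} {w : Fin m → Vec d} {t} → MeetsTangent w t →
    ∃ λ ((α , β) : Carrier × Carrier) → ¬ (α ≈ 0# × β ≈ 0#) ×
      ∀ h → Annihilates h w → α * dot (a d t) h + β * dot (ȧ d t) h ≈ 0#
  tangent-condition {d} {m} {w} {t} (v , v≢0 , ((α , β) , v≈αa+βȧ) , (cs , v≈Σcw)) =
    (α , β) , αβ≉0 , λ h h⊥w → begin
      α * dot (a d t) h + β * dot (ȧ d t) h
        ≈⟨ +-cong (dot-*ˡ α (a d t) h) (dot-*ˡ β (ȧ d t) h) ⟨
      dot (λ i → α * a d t i) h + dot (λ i → β * ȧ d t i) h
        ≈⟨ dot-+ˡ (λ i → α * a d t i) (λ i → β * ȧ d t i) h ⟨
      dot (λ i → α * a d t i + β * ȧ d t i) h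
        ≈⟨ dot-congˡ h (λ i → trans (sym (v≈αa+βȧ i)) (v≈Σcw i)) ⟩
      dot (lincomb cs w) h
        ≈⟨ dot-lincomb cs w h ⟩
      sum (λ k → cs k * dot (w k) h)
        ≈⟨ sum-zero {m} (λ k → trans (*-congˡ (h⊥w k)) (zeroʳ _)) ⟩
      0#
        ∎
    where
    αβ≉0 : ¬ (α ≈ 0# × β ≈ 0#)
    αβ≉0 (α≈0 , β≈0) = v≢0 λ i → trans (v≈αa+βȧ i)
      (trans (+-cong (trans (*-congʳ α≈0) (zeroˡ _)) (trans (*-congʳ β≈0) (zeroˡ _))) (+-identityʳ 0#))

  dot-init : ∀ {n} (u h : Vector Carrier (suc n)) → V.last h ≈ 0# → dot u h ≈ dot (V.init u) (V.init h)
  dot-init u h last≈0 = trans (sum-init-last (λ i → u i * h i))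
    (trans (+-congˡ (trans (*-congˡ last≈0) (zeroʳ _))) (+-identityʳ _))

  init-last≈0 : ∀ {n} (f : Vector Carrier (suc n)) → (∀ i → V.init f i ≈ 0#) → V.last f ≈ 0# →
                ∀ i → f i ≈ 0#
  init-last≈0 {zero}  f _      last≈0 zero    = last≈0
  init-last≈0 {suc n} f init≈0 _      zero    = init≈0 zero
  init-last≈0 {suc n} f init≈0 last≈0 (suc i) = init-last≈0 (tail f) (init≈0 ∘ suc) last≈0 i

  nonZero-init : ∀ {n} (f : Vec (suc n)) → NonZero f → V.last f ≈ 0# → NonZero (V.init f)
  nonZero-init f f≢0 last≈0 init≈0 = f≢0 (init-last≈0 f init≈0 last≈0)

  eval-tabulate-init : ∀ {n} (f : Vec (suc n)) t → V.last f ≈ 0# →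
    eval (tabulate (V.init f)) t ≈ dot (a (suc n) t) f ×
    eval (derivative (tabulate (V.init f))) t ≈ dot (ȧ (suc n) t) f
  eval-tabulate-init {n} f t last≈0 = (begin
      eval (tabulate (V.init f)) t                  ≈⟨ eval-tabulate (V.init f) t ⟩
      dot (a n t) (V.init f)                        ≈⟨ dot-congˡ (V.init f) (toℕ-inject₁-cong (t ^_)) ⟩
      dot (V.init (a (suc n) t)) (V.init f)         ≈⟨ dot-init (a (suc n) t) f last≈0 ⟨
      dot (a (suc n) t) f                           ∎)
    , (begin
      eval (derivative (tabulate (V.init f))) t     ≈⟨ eval-derivative-tabulate (V.init f) t ⟩
      dot (ȧ n t) (V.init f)                        ≈⟨ dot-congˡ (V.init f) (toℕ-inject₁-cong ȧ-entry) ⟩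
      dot (V.init (ȧ (suc n) t)) (V.init f)         ≈⟨ dot-init (ȧ (suc n) t) f last≈0 ⟨
      dot (ȧ (suc n) t) f                           ∎)
    where
    ȧ-entry : ℕ → Carrier
    ȧ-entry k = natF k * t ^ (k ∸ 1)
    toℕ-inject₁-cong : ∀ (g : ℕ → Carrier) (i : Fin (suc n)) → g (toℕ i) ≈ g (toℕ (Fin.inject₁ i))
    toℕ-inject₁-cong g i = reflexive (≡.cong g (≡.sym (Fin.toℕ-inject₁ i)))

  ¬isZero-tabulate : ∀ {n} {h : Vec n} → NonZero h → ¬ IsZero (tabulate h)
  ¬isZero-tabulate {h = h} h≢0 H≈0 =
    h≢0 λ i → trans (reflexive (≡.sym (coef-tabulate h i))) (H≈0 (toℕ i))

  coef-tabulate≉0⇒< : ∀ {n} (h : Vector Carrier n) {i} → ¬ coef (tabulate h) i ≈ 0# → i < n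
  coef-tabulate≉0⇒< h {i} hᵢ≉0 =
    ≡.subst (i <_) (length-tabulate h) (coef≉0⇒<length (tabulate h) i hᵢ≉0)

  wronskian-vanishes : ∀ {n m} {w : Fin m → Vec (suc n)} → (∀ t → MeetsTangent w t) →
    ∀ f g → Annihilates f w → Annihilates g w → V.last f ≈ 0# →
    ∀ t → ¬ ¬ (eval (wronskian (tabulate (V.init f)) (tabulate g)) t ≈ 0#)
  wronskian-vanishes meets f g f⊥w g⊥w last≈0 t =
    let ((α , β) , αβ≉0 , kills) = tangent-condition (meets t)
        (Fₜ , F′ₜ) = eval-tabulate-init f t last≈0
    in wronskian-root (tabulate (V.init f)) (tabulate g) t αβ≉0
         (trans (+-cong (*-congˡ Fₜ) (*-congˡ F′ₜ)) (kills f f⊥w))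
         (trans (+-cong (*-congˡ (eval-tabulate g t)) (*-congˡ (eval-derivative-tabulate g t))) (kills g g⊥w))

  no-subspace-meets-all-tangents : ∀ n → CharExceeds (suc (suc n)) →
    (r : Fin (2 ℕ.* suc (suc n) ∸ 1) → Carrier) → Injective _≡_ _≈_ r →
    (w : Fin (suc n) → Vec (suc (suc n))) → ¬ (∀ t → MeetsTangent w t)
  no-subspace-meets-all-tangents n char r r-inj w meets =
    ¬¬-annihilator ℕ.≤-refl w (Fin.fromℕ d) λ (f , f≢0 , f-last≈0 , f⊥w) →
    let F = tabulate (V.init f) in
    ¬¬-lowest-nonzero-coef F (¬isZero-tabulate (nonZero-init f f≢0 f-last≈0)) λ (i , Fᵢ≉0 , F<i) →
    let i<d = coef-tabulate≉0⇒< (V.init f) Fᵢ≉0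
        i<1+d = ℕ.m<n⇒m<1+n i<d
    in
    ¬¬-annihilator ℕ.≤-refl w (Fin.fromℕ< i<1+d) λ (g , g≢0 , gᵢ≈0 , g⊥w) →
    let G = tabulate g
        Gᵢ≈0 = trans (reflexive (≡.trans (≡.cong (coef G) (≡.sym (Fin.toℕ-fromℕ< i<1+d)))
                                          (coef-tabulate g (Fin.fromℕ< i<1+d)))) gᵢ≈0
    in
    ¬¬-lowest-nonzero-coef G (¬isZero-tabulate g≢0) λ (j , Gⱼ≉0 , G<j) →
    ¬¬-Π-Fin _ (λ k → wronskian-vanishes {w = w} meets f g f⊥w g⊥w f-last≈0 (r k)) λ roots →
    ¬isZero-wronskian F G i j char (ℕ.<⇒≤ i<d) (ℕ.s≤s⁻¹ (coef-tabulate≉0⇒< g Gⱼ≉0))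
      (λ { ≡.refl → Gⱼ≉0 Gᵢ≈0 }) Fᵢ≉0 F<i Gⱼ≉0 G<j
      (isZero-of-roots (wronskian F G) (length-wronskian {F} {G} d (s≤s (s≤s z≤n))
        (ℕ.≤-reflexive (length-tabulate (V.init f))) (ℕ.≤-reflexive (length-tabulate g))) r r-inj roots)
    where d = suc (suc n)

open import Data.Nat using (_*_)

mainTheorem6 : ∀ {c ℓ} (F : Field c ℓ) (d : ℕ) → 2 ≤ d →
    (FieldDefs.CharZero F
    ⊎ (∃ λ p → FieldDefs.CharIs F p × d < p × FieldDefs.CardAtLeast F (2 * d ∸ 1))) →
    ¬ (Σ (Fin (d ∸ 1) → FieldDefs.Vec F d) λ w →
    FieldDefs.LinIndep F w × (∀ (t : Field.Carrier F) → FieldDefs.MeetsTangent F w t))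
mainTheorem6 F 1 (s≤s ())
mainTheorem6 F (suc (suc n)) _ (inj₁ char0) (w , _ , meets) =
  no-subspace-meets-all-tangents F n (charZero⇒charExceeds F char0 _)
    (λ i → FieldDefs.natF F (toℕ i)) (natF∘toℕ-injective F (charZero⇒charExceeds F char0 _)) w meets
mainTheorem6 F (suc (suc n)) _ (inj₂ (p , (_ , _ , p-minimal) , d<p , r , r-injective)) (w , _ , meets) =
  no-subspace-meets-all-tangents F n (λ k 0<k k≤d → p-minimal k 0<k (ℕ.≤-<-trans k≤d d<p))
    r (λ {i} {j} → r-injective i j) w meets
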